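{- Let $Q=(q_n)_{n\ge1}$ be a basic sequence that is infinite in limit, let $k\in\mathbb{N}$, and let $x=E_0.E_1E_2\cdots$ w.r.t. $Q$ be $Q$-normal of order $k$. Then there exists a real number $y=F_0.F_1F_2\cdots$ w.r.t. $Q$ such that the set $\{n : E_n\neq F_n\}$ has natural density zero and $y$ is not $Q$-normal of order $j$ for any $j\ge 1$.
   Context: A basic sequence is a sequence $Q=(q_n)_{n\ge1}$ of integers $q_n\ge 2$. The $Q$-Cantor series expansion of a real $x$ is the unique expansion $x=E_0+\sum_{n\ge1}\frac{E_n}{q_1\cdots q_n}$ with $E_0=\lfloor x\rfloor$, $E_n\in\{0,1,\dots,q_n-1\}$ for $n\ge1$, and $E_n\neq q_n-1$ infinitely often; this is written $x=E_0.E_1E_2\cdots$ w.r.t. $Q$. $Q$ is infinite in limit if $q_n\to\infty$. For a block $B=(b_1,\dots,b_k)$ of nonnegative integers, $N_n^Q(B,x)$ is the number of indices $i\le n$ with $(E_i,\dots,E_{i+k-1})=B$. Let $Q_n^{(k)}=\sum_{j=1}^n \frac{1}{q_jq_{j+1}\cdots q_{j+k-1}}$. A real $x$ is $Q$-normal of order $k$ if $\lim_{n\to\infty} N_n^Q(B,x)/Q_n^{(k)}=1$ for every block $B$ of length $k$. A set $A\subseteq\mathbb{N}$ has density zero if $\#(A\cap\{1,\dots,n\})/n\to0$. -}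

module Defs where

open import Data.Nat as ℕ using (ℕ; zero; suc; _+_; _*_; _∸_; _≤_; _<_)
open import Data.Nat.Properties using (_≟_)
open import Data.Integer using (ℤ; +_; -[1+_])
open import Data.Fin using (Fin; toℕ)
open import Data.Vec using (Vec; tabulate)
import Data.Vec.Properties as VecP
open import Data.Rational as ℚ using (ℚ; mkℚ; 0ℚ; 1ℚ; _÷_; _-_; ∣_∣)
open import Data.Product using (Σ; ∃; _×_)
open import Relation.Nullary using (¬_; yes; no)

-- A basic sequence Q = (q_n)_{n ≥ 1} is represented by a function q : ℕ → ℕ;
-- the value q 0 is a dummy (indices start at 1).
IsBasic : (ℕ → ℕ) → Set
IsBasic q = ∀ n → 1 ≤ n → 2 ≤ q n

InfiniteInLimit : (ℕ → ℕ) → Set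
InfiniteInLimit q = ∀ M → ∃ λ N → ∀ n → N ≤ n → M ≤ q n

-- E : ℕ → ℕ is the digit sequence E_1 E_2 ... of a Q-Cantor series expansion
-- (E 0 is a dummy; the integer part E_0 plays no role).
IsExpansion : (ℕ → ℕ) → (ℕ → ℕ) → Set
IsExpansion q E =
  (∀ n → 1 ≤ n → E n < q n) ×
  (∀ m → ∃ λ n → m < n × ¬ (E n ≡ q n ∸ 1))
  where open import Relation.Binary.PropositionalEquality using (_≡_)

prodQ : (ℕ → ℕ) → ℕ → ℕ → ℕ
prodQ q j zero    = 1
prodQ q j (suc k) = q j * prodQ q (suc j) k

-- 1/m as a rational (m ≥ 1; value 0 for m = 0, never used for basic sequences)
invℕ : ℕ → ℚ
invℕ zero    = 0ℚ
invℕ (suc m) = + 1 ℚ./ suc m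

Qnk : (ℕ → ℕ) → ℕ → ℕ → ℚ
Qnk q k zero    = 0ℚ
Qnk q k (suc n) = Qnk q k n ℚ.+ invℕ (prodQ q (suc n) k)

window : (ℕ → ℕ) → ℕ → (k : ℕ) → Vec ℕ k
window E i k = tabulate (λ t → E (i + toℕ t))

countBlock : ∀ {k} → Vec ℕ k → (ℕ → ℕ) → ℕ → ℕ
countBlock {k} B E zero = 0
countBlock {k} B E (suc n) with VecP.≡-dec _≟_ (window E (suc n) k) B
... | yes _ = suc (countBlock B E n)
... | no  _ = countBlock B E n

-- total division on ℚ (a ÷ b, and 0 when b = 0)
_÷ᵗ_ : ℚ → ℚ → ℚ
p ÷ᵗ mkℚ (+ zero)    d c = 0ℚ
p ÷ᵗ q@(mkℚ (+ suc n) d c) = p ÷ q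
p ÷ᵗ q@(mkℚ -[1+ n ] d c) = p ÷ q

ConvergesTo : (ℕ → ℚ) → ℚ → Set
ConvergesTo a L = ∀ ε → 0ℚ ℚ.< ε → ∃ λ N → ∀ n → N ≤ n → ∣ a n - L ∣ ℚ.< ε

QNormal : (ℕ → ℕ) → ℕ → (ℕ → ℕ) → Set
QNormal q k E = (B : Vec ℕ k) →
  ConvergesTo (λ n → (+ countBlock B E n ℚ./ 1) ÷ᵗ Qnk q k n) 1ℚ

countDiff : (ℕ → ℕ) → (ℕ → ℕ) → ℕ → ℕ
countDiff E F zero = 0
countDiff E F (suc n) with E (suc n) ≟ F (suc n)
... | yes _ = countDiff E F n
... | no  _ = suc (countDiff E F n)

DiffDensityZero : (ℕ → ℕ) → (ℕ → ℕ) → Set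
DiffDensityZero E F =
  ConvergesTo (λ n → (+ countDiff E F n ℚ./ 1) ÷ᵗ (+ n ℚ./ 1)) 0ℚ

module Submission where

open import Defs
open import Data.Nat using (ℕ; _≤_)
open import Data.Product using (Σ; ∃; _×_)
open import Relation.Nullary using (¬_)

open import Data.Nat as ℕ using (zero; suc; _+_; _*_; _∸_; _<_; _≤?_; _<?_; _≟_; z≤n; s≤s)
import Data.Nat.Properties as ℕP
open import Data.Nat.Tactic.RingSolver using (solve-∀)
open import Data.Nat.Coprimality using (1-coprimeTo) renaming (sym to coprime-sym)
open import Data.Integer as ℤ using (+_; +≤+; +<+)
import Data.Integer.Properties as ℤP
open import Data.Rational as ℚ using (ℚ; mkℚ; 0ℚ; 1ℚ; toℚᵘ)
import Data.Rational.Properties as ℚP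
import Data.Rational.Unnormalised as ℚᵘ
import Data.Rational.Unnormalised.Properties as ℚᵘP
open import Data.Fin using (toℕ)
open import Data.Fin.Properties using (toℕ<n)
open import Data.Vec using (Vec; tabulate)
import Data.Vec.Properties as VecP
open import Data.Product using (_,_; proj₁; proj₂)
open import Data.Sum using (_⊎_; inj₁; inj₂)
open import Data.Empty using (⊥-elim)
open import Function using (_∘_)
open import Relation.Nullary using (Dec; yes; no)
open import Relation.Nullary.Decidable using (map′; _×-dec_)
open import Relation.Binary.Definitions using (tri<; tri≈; tri>)
open import Relation.Binary.PropositionalEquality

-- Changing the digits of x on a set of density zero can destroy Q-normality of
-- every order.
--
-- Let N(M) be an index from which on q_i ≥ M.  Run m of zeros is the interval
-- [m·ℓ_m, (m+1)·ℓ_m), where ℓ_0 = 0 and ℓ_{m+1} = (m+1)·ℓ_m + 4·N(8(m+1)) + 3(m+1);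
-- F is E with every digit inside a run replaced by 0.
--  * F is again a Q-expansion: 0 is an admissible digit and never equals q_n − 1.
--  * The runs have density zero: everything up to the end of run m is shorter than
--    run m + 1, which starts at (m+1)·ℓ_{m+1}; so up to n at most 2n/(m+1) positions
--    lie in runs once n is in phase m + 1 (module Runs, lemma sparse).
--  * F is not normal of any order j: at the end of run m ≥ j the zero block 0^j has
--    occurred about ℓ_m times, while Q_n^{(j)} ≤ N(8m) + n/(8m) with n ≈ (m+1)·ℓ_m,
--    so N_n/Q_n ≥ 2 infinitely often (lemma not-normal).
-- The file first counts decidable sets, builds the runs, then proves the rational
-- estimates for Q_n^{(j)} and the non-normality criterion, and finally combines them.

module Counting {P : ℕ → Set} (P? : ∀ i → Dec (P i)) where

  count : ℕ → ℕ
  count zero = 0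
  count (suc n) with P? n
  ... | yes _ = suc (count n)
  ... | no  _ = count n

  count-+ : ∀ s t → count (s + t) ≤ count s + t
  count-+ s zero rewrite ℕP.+-identityʳ s | ℕP.+-identityʳ (count s) = ℕP.≤-refl
  count-+ s (suc t) rewrite ℕP.+-suc s t | ℕP.+-suc (count s) t with P? (s + t)
  ... | yes _ = s≤s (count-+ s t)
  ... | no  _ = ℕP.m≤n⇒m≤1+n (count-+ s t)

  count-gap : ∀ s t → (∀ u → u < t → ¬ P (s + u)) → count (s + t) ≡ count s
  count-gap s zero free rewrite ℕP.+-identityʳ s = refl
  count-gap s (suc t) free rewrite ℕP.+-suc s t with P? (s + t)
  ... | yes p = ⊥-elim (free t ℕP.≤-refl p)
  ... | no  _ = count-gap s t (λ u u<t → free u (ℕP.m<n⇒m<1+n u<t))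

  count-window : ∀ s ℓ n → s ≤ n → (∀ i → s + ℓ ≤ i → i < n → ¬ P i) →
                 count n ≤ count s + ℓ
  count-window s ℓ n s≤n free with n ≤? s + ℓ
  ... | yes n≤s+ℓ = begin
      count n               ≡⟨ cong count (sym (ℕP.m+[n∸m]≡n s≤n)) ⟩
      count (s + (n ∸ s))   ≤⟨ count-+ s (n ∸ s) ⟩
      count s + (n ∸ s)     ≤⟨ ℕP.+-monoʳ-≤ (count s) (ℕP.m≤n+o⇒m∸n≤o n s n≤s+ℓ) ⟩
      count s + ℓ           ∎
    where open ℕP.≤-Reasoning
  ... | no  n≰s+ℓ = begin
      count n                              ≡⟨ cong count (sym (ℕP.m+[n∸m]≡n s+ℓ≤n)) ⟩
      count (s + ℓ + (n ∸ (s + ℓ)))        ≡⟨ count-gap (s + ℓ) (n ∸ (s + ℓ)) gap ⟩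
      count (s + ℓ)                        ≤⟨ count-+ s ℓ ⟩
      count s + ℓ                          ∎
    where
      open ℕP.≤-Reasoning
      s+ℓ≤n : s + ℓ ≤ n
      s+ℓ≤n = ℕP.<⇒≤ (ℕP.≰⇒> n≰s+ℓ)
      gap : ∀ u → u < n ∸ (s + ℓ) → ¬ P (s + ℓ + u)
      gap u u<t = free (s + ℓ + u) (ℕP.m≤m+n (s + ℓ) u)
        (subst (s + ℓ + u <_) (ℕP.m+[n∸m]≡n s+ℓ≤n) (ℕP.+-monoʳ-< (s + ℓ) u<t))

  countDiff-≤ : ∀ E F → (∀ i → ¬ P i → F i ≡ E i) → ∀ n → countDiff E F n ≤ count (suc n)
  countDiff-≤ E F agree zero = z≤n
  countDiff-≤ E F agree (suc n) with E (suc n) ≟ F (suc n) | P? (suc n)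
  ... | yes _   | yes _  = ℕP.m≤n⇒m≤1+n (countDiff-≤ E F agree n)
  ... | yes _   | no  _  = countDiff-≤ E F agree n
  ... | no  _   | yes _  = s≤s (countDiff-≤ E F agree n)
  ... | no  E≢F | no  ¬p = ⊥-elim (E≢F (sym (agree (suc n) ¬p)))

module Increasing (a : ℕ → ℕ) (a-inc : ∀ m → a m < a (suc m)) where

  mono : ∀ {m m'} → m ≤ m' → a m ≤ a m'
  mono {m} {m'} m≤m' = subst (λ k → a m ≤ a k) (ℕP.m+[n∸m]≡n m≤m') (go (m' ∸ m))
    where
      go : ∀ d → a m ≤ a (m + d)
      go zero    = ℕP.≤-reflexive (cong a (sym (ℕP.+-identityʳ m)))
      go (suc d) = ℕP.≤-trans (go d)
        (ℕP.≤-trans (ℕP.<⇒≤ (a-inc (m + d))) (ℕP.≤-reflexive (cong a (sym (ℕP.+-suc m d)))))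

  index-≤ : ∀ m' m {n} → a m' ≤ n → n < a (suc m) → m' ≤ m
  index-≤ m' m am'≤n n<a with m' ≤? m
  ... | yes m'≤m = m'≤m
  ... | no  m'≰m = ⊥-elim (ℕP.<-irrefl refl
        (ℕP.<-≤-trans n<a (ℕP.≤-trans (mono (ℕP.≰⇒> m'≰m)) am'≤n)))

  phase : ∀ n → a 0 ≤ n → ∃ λ m → a m ≤ n × n < a (suc m)
  phase zero a0≤0 = 0 , a0≤0 , ℕP.≤-<-trans z≤n (a-inc 0)
  phase (suc n) a0≤1+n with a 0 ≤? n
  ... | no  a0≰n = 0 , a0≤1+n ,
        subst (_< a 1) (sym (ℕP.≤-antisym (ℕP.≰⇒> a0≰n) a0≤1+n)) (a-inc 0)
  ... | yes a0≤n with phase n a0≤n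
  ...   | m , am≤n , n<am+1 with suc n <? a (suc m)
  ...     | yes 1+n<am+1 = m , ℕP.m≤n⇒m≤1+n am≤n , 1+n<am+1
  ...     | no  1+n≮am+1 = suc m , ℕP.≮⇒≥ 1+n≮am+1 ,
            subst (_< a (suc (suc m))) (sym (ℕP.≤-antisym n<am+1 (ℕP.≮⇒≥ 1+n≮am+1))) (a-inc (suc m))

scaled-bound : ∀ K c ℓ n → c ≤ ℓ + ℓ → 1 ≤ ℓ → suc (suc (K + K)) * ℓ ≤ suc n → K * c < n
scaled-bound K c ℓ n c≤2ℓ 1≤ℓ le = ℕ.s≤s⁻¹ (begin
  suc (suc (K * c))            ≤⟨ s≤s (s≤s (ℕP.*-monoʳ-≤ K c≤2ℓ)) ⟩
  suc (suc (K * (ℓ + ℓ)))      ≡⟨ cong (suc ∘ suc) (double K ℓ) ⟩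
  2 + (K + K) * ℓ              ≤⟨ ℕP.+-monoˡ-≤ ((K + K) * ℓ) (ℕP.+-mono-≤ 1≤ℓ 1≤ℓ) ⟩
  ℓ + ℓ + (K + K) * ℓ          ≡⟨ ℕP.+-assoc ℓ ℓ ((K + K) * ℓ) ⟩
  suc (suc (K + K)) * ℓ        ≤⟨ le ⟩
  suc n                        ∎)
  where
    open ℕP.≤-Reasoning
    double : ∀ K ℓ → K * (ℓ + ℓ) ≡ (K + K) * ℓ
    double = solve-∀

HasLongZeroRuns : (ℕ → ℕ) → (ℕ → ℕ) → Set
HasLongZeroRuns L F = ∀ m → 1 ≤ m →
  ∃ λ ℓ → L m ≤ ℓ × (∀ u → u < ℓ → F (m * ℓ + u) ≡ 0)

-- Run m is the interval [m·len m, (m+1)·len m) and has length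
-- at least G m; run m + 1 is longer than everything up to the end of run m, yet it
-- starts only at m + 1 times its own length, so the runs have density zero.
module Runs (G : ℕ → ℕ) (G-≥ : ∀ m → m ≤ G m) where

  len : ℕ → ℕ
  len zero    = 0
  len (suc m) = suc m * len m + G (suc m)

  runStart : ℕ → ℕ
  runStart m = m * len m

  runEnd : ℕ → ℕ
  runEnd m = runStart m + len m

  InRun : ℕ → Set
  InRun i = ∃ λ m → runStart m ≤ i × i < runEnd m

  G≤len : ∀ m → G (suc m) ≤ len (suc m)
  G≤len m = ℕP.m≤n+m (G (suc m)) (suc m * len m)

  1≤G : ∀ m → 1 ≤ G (suc m)
  1≤G m = ℕP.≤-trans (s≤s z≤n) (G-≥ (suc m))

  runEnd<len : ∀ m → runEnd m < len (suc m)
  runEnd<len m = begin-strict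
    runStart m + len m          ≡⟨ ℕP.+-comm (runStart m) (len m) ⟩
    suc m * len m               <⟨ ℕP.m<m+n (suc m * len m) (1≤G m) ⟩
    suc m * len m + G (suc m)   ∎
    where open ℕP.≤-Reasoning

  len≤runStart : ∀ m → len (suc m) ≤ runStart (suc m)
  len≤runStart m = ℕP.m≤n*m (len (suc m)) (suc m)

  runEnd<runStart : ∀ m → runEnd m < runStart (suc m)
  runEnd<runStart m = ℕP.<-≤-trans (runEnd<len m) (len≤runStart m)

  runStart-inc : ∀ m → runStart m < runStart (suc m)
  runStart-inc m = ℕP.≤-<-trans (ℕP.m≤m+n (runStart m) (len m)) (runEnd<runStart m)

  open Increasing runStart runStart-inc

  index≤runStart : ∀ m → m ≤ runStart m
  index≤runStart zero    = z≤n
  index≤runStart (suc m) = ℕP.m≤m*n (suc m) (len (suc m)) {{ℕ.>-nonZero (ℕP.≤-trans (1≤G m) (G≤len m))}}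

  gap-free : ∀ m i → runEnd m ≤ i → i < runStart (suc m) → ¬ InRun i
  gap-free m i end≤i i<start (m' , start≤i , i<end) with ℕP.<-cmp m' m
  ... | tri< m'<m _ _ = ℕP.<-irrefl refl (ℕP.<-≤-trans i<end
        (ℕP.≤-trans (ℕP.<⇒≤ (runEnd<runStart m'))
          (ℕP.≤-trans (mono m'<m) (ℕP.≤-trans (ℕP.m≤m+n (runStart m) (len m)) end≤i))))
  ... | tri≈ _ refl _ = ℕP.<-irrefl refl (ℕP.<-≤-trans i<end end≤i)
  ... | tri> _ _ m<m' = ℕP.<-irrefl refl (ℕP.<-≤-trans i<start (ℕP.≤-trans (mono m<m') start≤i))

  -- membership in a run is decidable, since only runs m ≤ i can contain i
  inRun? : ∀ i → Dec (InRun i)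
  inRun? i = map′ (λ (m , _ , p) → m , p) (λ (m , p) → m , s≤s (ℕP.≤-trans (index≤runStart m) (proj₁ p)) , p)
    (ℕP.anyUpTo? (λ m → (runStart m ≤? i) ×-dec (i <? runEnd m)) (suc i))

  open Counting inRun? public

  count-phase : ∀ m n → runStart (suc m) ≤ n → n ≤ runStart (suc (suc m)) →
                count n ≤ len (suc m) + len (suc m)
  count-phase m n start≤n n≤start = begin
    count n                                  ≤⟨ count-window (runStart (suc m)) (len (suc m)) n start≤n
                                                  (λ i end≤i i<n → gap-free (suc m) i end≤i (ℕP.<-≤-trans i<n n≤start)) ⟩
    count (runStart (suc m)) + len (suc m)   ≤⟨ ℕP.+-monoˡ-≤ (len (suc m)) prefix ⟩
    len (suc m) + len (suc m)                ∎
    where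
      open ℕP.≤-Reasoning
      prefix : count (runStart (suc m)) ≤ len (suc m)
      prefix = ℕP.≤-trans (count-window 0 (runEnd m) (runStart (suc m)) z≤n (gap-free m))
                 (ℕP.<⇒≤ (runEnd<len m))

  sparse : ∀ K → ∃ λ N → ∀ n → N ≤ n → K * count (suc n) < n
  sparse K = runStart (suc (suc (K + K))) , bound
    where
      bound : ∀ n → runStart (suc (suc (K + K))) ≤ n → K * count (suc n) < n
      bound n N≤n with phase (suc n) z≤n
      ... | zero , _ , 1+n<start with index-≤ (suc (suc (K + K))) 0 (ℕP.m≤n⇒m≤1+n N≤n) 1+n<start
      ...   | ()
      bound n N≤n | suc m , start≤1+n , 1+n<start =
        scaled-bound K (count (suc n)) (len (suc m)) n
          (count-phase m (suc n) start≤1+n (ℕP.<⇒≤ 1+n<start))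
          (ℕP.≤-trans (1≤G m) (G≤len m))
          (ℕP.≤-trans (ℕP.*-monoˡ-≤ (len (suc m)) late) start≤1+n)
        where
          late : suc (suc (K + K)) ≤ suc m
          late = index-≤ (suc (suc (K + K))) (suc m) (ℕP.m≤n⇒m≤1+n N≤n) 1+n<start

  zeroRuns : (ℕ → ℕ) → ℕ → ℕ
  zeroRuns E i with inRun? i
  ... | yes _ = 0
  ... | no  _ = E i

  zeroRuns-digit : ∀ E i → zeroRuns E i ≡ 0 ⊎ zeroRuns E i ≡ E i
  zeroRuns-digit E i with inRun? i
  ... | yes _ = inj₁ refl
  ... | no  _ = inj₂ refl

  zeroRuns-in : ∀ E i → InRun i → zeroRuns E i ≡ 0
  zeroRuns-in E i p with inRun? i
  ... | yes _ = refl
  ... | no ¬p = ⊥-elim (¬p p)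

  zeroRuns-out : ∀ E i → ¬ InRun i → zeroRuns E i ≡ E i
  zeroRuns-out E i ¬p with inRun? i
  ... | yes p = ⊥-elim (¬p p)
  ... | no  _ = refl

  zeroRuns-long : ∀ E → HasLongZeroRuns G (zeroRuns E)
  zeroRuns-long E (suc m) _ = len (suc m) , G≤len m , λ u u<len →
    zeroRuns-in E (runStart (suc m) + u)
      (suc m , ℕP.m≤m+n (runStart (suc m)) u , ℕP.+-monoʳ-< (runStart (suc m)) u<len)

zeroing-expansion : ∀ q E F → IsBasic q → IsExpansion q E →
                    (∀ n → F n ≡ 0 ⊎ F n ≡ E n) → IsExpansion q F
zeroing-expansion q E F basic (E<q , E≠q-1) F≡0∨E = F<q , F≠q-1
  where
    0<q : ∀ n → 1 ≤ n → 0 < q n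
    0<q n 1≤n = ℕP.≤-trans (s≤s z≤n) (basic n 1≤n)

    F<q : ∀ n → 1 ≤ n → F n < q n
    F<q n 1≤n with F≡0∨E n
    ... | inj₁ F≡0 = subst (_< q n) (sym F≡0) (0<q n 1≤n)
    ... | inj₂ F≡E = subst (_< q n) (sym F≡E) (E<q n 1≤n)

    -- 0 is never the top digit q n - 1, since q n ≥ 2
    F≠q-1 : ∀ m → ∃ λ n → m < n × ¬ (F n ≡ q n ∸ 1)
    F≠q-1 m with E≠q-1 m
    ... | n , m<n , En≠top with F≡0∨E n
    ...   | inj₂ F≡E = n , m<n , λ F≡top → En≠top (trans (sym F≡E) F≡top)
    ...   | inj₁ F≡0 = n , m<n , λ F≡top → ℕP.<-irrefl refl
            (ℕP.≤-trans (basic n (ℕP.≤-trans (s≤s z≤n) m<n))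
              (ℕP.≤-trans (ℕP.m≤n+m∸n (q n) 1) (ℕP.≤-reflexive (cong suc (trans (sym F≡top) F≡0)))))

ι : ℕ → ℚ
ι n = + n ℚ./ 1

ι-mkℚ : ∀ n → ι n ≡ mkℚ (+ n) 0 (coprime-sym (1-coprimeTo n))
ι-mkℚ n = ℚP.↥p/↧p≡p (mkℚ (+ n) 0 (coprime-sym (1-coprimeTo n)))

toℚᵘ-ι : ∀ n → toℚᵘ (ι n) ≡ ℚᵘ.mkℚᵘ (+ n) 0
toℚᵘ-ι n = cong toℚᵘ (ι-mkℚ n)

ι-+ : ∀ a b → ι (a + b) ≡ ι a ℚ.+ ι b
ι-+ a b = ℚP.toℚᵘ-injective (begin
  toℚᵘ (ι (a + b))                               ≡⟨ toℚᵘ-ι (a + b) ⟩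
  ℚᵘ.mkℚᵘ (+ (a + b)) 0                          ≈⟨ ℚᵘ.*≡* numerators ⟩
  ℚᵘ.mkℚᵘ (+ a) 0 ℚᵘ.+ ℚᵘ.mkℚᵘ (+ b) 0           ≡⟨ sym (cong₂ ℚᵘ._+_ (toℚᵘ-ι a) (toℚᵘ-ι b)) ⟩
  toℚᵘ (ι a) ℚᵘ.+ toℚᵘ (ι b)                     ≈⟨ ℚᵘP.≃-sym (ℚP.toℚᵘ-homo-+ (ι a) (ι b)) ⟩
  toℚᵘ (ι a ℚ.+ ι b)                             ∎)
  where
    open ℚᵘP.≃-Reasoning
    numerators : + (a + b) ℤ.* + 1 ≡ (+ a ℤ.* + 1 ℤ.+ + b ℤ.* + 1) ℤ.* + 1
    numerators = cong (ℤ._* + 1) (trans (ℤP.pos-+ a b)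
      (sym (cong₂ ℤ._+_ (ℤP.*-identityʳ (+ a)) (ℤP.*-identityʳ (+ b)))))

ι-* : ∀ a b → ι (a * b) ≡ ι a ℚ.* ι b
ι-* a b = ℚP.toℚᵘ-injective (begin
  toℚᵘ (ι (a * b))                               ≡⟨ toℚᵘ-ι (a * b) ⟩
  ℚᵘ.mkℚᵘ (+ (a * b)) 0                          ≈⟨ ℚᵘ.*≡* (cong (ℤ._* + 1) (ℤP.pos-* a b)) ⟩
  ℚᵘ.mkℚᵘ (+ a) 0 ℚᵘ.* ℚᵘ.mkℚᵘ (+ b) 0           ≡⟨ sym (cong₂ ℚᵘ._*_ (toℚᵘ-ι a) (toℚᵘ-ι b)) ⟩
  toℚᵘ (ι a) ℚᵘ.* toℚᵘ (ι b)                     ≈⟨ ℚᵘP.≃-sym (ℚP.toℚᵘ-homo-* (ι a) (ι b)) ⟩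
  toℚᵘ (ι a ℚ.* ι b)                             ∎)
  where open ℚᵘP.≃-Reasoning

ι-mono-≤ : ∀ {a b} → a ≤ b → ι a ℚ.≤ ι b
ι-mono-≤ {a} {b} a≤b rewrite ι-mkℚ a | ι-mkℚ b =
  ℚ.*≤* (subst₂ ℤ._≤_ (sym (ℤP.*-identityʳ (+ a))) (sym (ℤP.*-identityʳ (+ b))) (+≤+ a≤b))

ι-mono-< : ∀ {a b} → a < b → ι a ℚ.< ι b
ι-mono-< {a} {b} a<b rewrite ι-mkℚ a | ι-mkℚ b =
  ℚ.*<* (subst₂ ℤ._<_ (sym (ℤP.*-identityʳ (+ a))) (sym (ℤP.*-identityʳ (+ b))) (+<+ a<b))

ι-cancel-< : ∀ {a b} → ι a ℚ.< ι b → a < b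
ι-cancel-< {a} {b} ιa<ιb with a ℕP.<? b
... | yes a<b = a<b
... | no  a≮b = ⊥-elim (ℚP.<-irrefl refl (ℚP.<-≤-trans ιa<ιb (ι-mono-≤ (ℕP.≮⇒≥ a≮b))))

ι-nonNeg : ∀ n → ℚ.NonNegative (ι n)
ι-nonNeg n = ℚ.nonNegative (ι-mono-≤ {0} {n} z≤n)

invℕ-mkℚ : ∀ m → invℕ (suc m) ≡ mkℚ (+ 1) m (1-coprimeTo (suc m))
invℕ-mkℚ m = ℚP.↥p/↧p≡p (mkℚ (+ 1) m (1-coprimeTo (suc m)))

invℕ-nonNeg : ∀ x → 0ℚ ℚ.≤ invℕ x
invℕ-nonNeg zero    = ℚP.≤-refl
invℕ-nonNeg (suc m) rewrite invℕ-mkℚ m = ℚP.<⇒≤ (ℚP.positive⁻¹ _)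

invℕ-pos : ∀ x → 1 ≤ x → 0ℚ ℚ.< invℕ x
invℕ-pos (suc m) _ rewrite invℕ-mkℚ m = ℚP.positive⁻¹ _

ι*invℕ : ∀ m → ι (suc m) ℚ.* invℕ (suc m) ≡ 1ℚ
ι*invℕ m rewrite ι-mkℚ (suc m) | invℕ-mkℚ m =
  ℚP.*-inverseʳ (mkℚ (+ suc m) 0 (coprime-sym (1-coprimeTo (suc m))))

scaled-invℕ-≤ : ∀ M x → M ≤ x → ι M ℚ.* invℕ x ℚ.≤ 1ℚ
scaled-invℕ-≤ zero    zero    z≤n = ℚP.<⇒≤ (ℚP.positive⁻¹ 1ℚ)
scaled-invℕ-≤ M       (suc m) M≤x = begin
  ι M ℚ.* invℕ (suc m)        ≤⟨ ℚP.*-monoʳ-≤-nonNeg (invℕ (suc m)) {{ℚ.nonNegative (invℕ-nonNeg (suc m))}} (ι-mono-≤ M≤x) ⟩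
  ι (suc m) ℚ.* invℕ (suc m)  ≡⟨ ι*invℕ m ⟩
  1ℚ                          ∎
  where open ℚP.≤-Reasoning

invℕ-≤1 : ∀ x → invℕ x ℚ.≤ 1ℚ
invℕ-≤1 zero    = ℚP.<⇒≤ (ℚP.positive⁻¹ 1ℚ)
invℕ-≤1 (suc m) = subst (ℚ._≤ 1ℚ) (ℚP.*-identityˡ (invℕ (suc m))) (scaled-invℕ-≤ 1 (suc m) (s≤s z≤n))

prodQ-≥1 : ∀ q → IsBasic q → ∀ i → 1 ≤ i → ∀ j → 1 ≤ prodQ q i j
prodQ-≥1 q basic i 1≤i zero    = s≤s z≤n
prodQ-≥1 q basic i 1≤i (suc j) =
  ℕP.*-mono-≤ (ℕP.≤-trans (s≤s z≤n) (basic i 1≤i)) (prodQ-≥1 q basic (suc i) (s≤s z≤n) j)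

prodQ-≥q : ∀ q → IsBasic q → ∀ i → 1 ≤ i → ∀ j → 1 ≤ j → q i ≤ prodQ q i j
prodQ-≥q q basic i 1≤i (suc j) _ = ℕP.m≤m*n (q i) (prodQ q (suc i) j)
  {{ℕ.>-nonZero (prodQ-≥1 q basic (suc i) (s≤s z≤n) j)}}

Qnk-nonNeg : ∀ q j n → 0ℚ ℚ.≤ Qnk q j n
Qnk-nonNeg q j zero    = ℚP.≤-refl
Qnk-nonNeg q j (suc n) = ℚP.+-mono-≤ (Qnk-nonNeg q j n) (invℕ-nonNeg (prodQ q (suc n) j))

Qnk-pos : ∀ q → IsBasic q → ∀ j n → 1 ≤ n → 0ℚ ℚ.< Qnk q j n
Qnk-pos q basic j (suc n) _ = ℚP.+-mono-≤-< (Qnk-nonNeg q j n)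
  (invℕ-pos (prodQ q (suc n) j) (prodQ-≥1 q basic (suc n) (s≤s z≤n) j))

Qnk-≤ : ∀ q j n → Qnk q j n ℚ.≤ ι n
Qnk-≤ q j zero    = ℚP.≤-refl
Qnk-≤ q j (suc n) = begin
  Qnk q j n ℚ.+ invℕ (prodQ q (suc n) j)   ≤⟨ ℚP.+-mono-≤ (Qnk-≤ q j n) (invℕ-≤1 (prodQ q (suc n) j)) ⟩
  ι n ℚ.+ ι 1                              ≡⟨ sym (ι-+ n 1) ⟩
  ι (n + 1)                                ≡⟨ cong ι (ℕP.+-comm n 1) ⟩
  ι (suc n)                                ∎
  where open ℚP.≤-Reasoning

-- if q_i ≥ M from index N on, then M·Q_n^{(j)} ≤ M·N + n: every term of Q is at
-- most 1, and from index N on at most 1/M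
Qnk-tail : ∀ q → IsBasic q → ∀ M N → (∀ i → N ≤ i → M ≤ q i) → ∀ j → 1 ≤ j → ∀ n →
           ι M ℚ.* Qnk q j n ℚ.≤ ι (M * N + n)
Qnk-tail q basic M N large j 1≤j zero =
  subst (ℚ._≤ ι (M * N + 0)) (sym (ℚP.*-zeroʳ (ι M))) (ι-mono-≤ {0} {M * N + 0} z≤n)
Qnk-tail q basic M N large j 1≤j (suc n) with N ℕP.≤? suc n
... | yes N≤1+n = begin
  ι M ℚ.* (Qnk q j n ℚ.+ t)             ≡⟨ ℚP.*-distribˡ-+ (ι M) (Qnk q j n) t ⟩
  ι M ℚ.* Qnk q j n ℚ.+ ι M ℚ.* t       ≤⟨ ℚP.+-mono-≤ (Qnk-tail q basic M N large j 1≤j n)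
                                            (scaled-invℕ-≤ M _ (ℕP.≤-trans (large (suc n) N≤1+n)
                                              (prodQ-≥q q basic (suc n) (s≤s z≤n) j 1≤j))) ⟩
  ι (M * N + n) ℚ.+ ι 1                 ≡⟨ sym (ι-+ (M * N + n) 1) ⟩
  ι (M * N + n + 1)                     ≡⟨ cong ι (trans (ℕP.+-assoc (M * N) n 1) (cong (λ k → M * N + k) (ℕP.+-comm n 1))) ⟩
  ι (M * N + suc n)                     ∎
  where
    open ℚP.≤-Reasoning
    t : ℚ
    t = invℕ (prodQ q (suc n) j)
... | no N≰1+n = begin
  ι M ℚ.* Qnk q j (suc n)     ≤⟨ ℚP.*-monoˡ-≤-nonNeg (ι M) {{ι-nonNeg M}} (Qnk-≤ q j (suc n)) ⟩
  ι M ℚ.* ι (suc n)           ≡⟨ sym (ι-* M (suc n)) ⟩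
  ι (M * suc n)               ≤⟨ ι-mono-≤ (ℕP.≤-trans (ℕP.*-monoʳ-≤ M (ℕP.<⇒≤ (ℕP.≰⇒> N≰1+n)))
                                  (ℕP.m≤m+n (M * N) (suc n))) ⟩
  ι (M * N + suc n)           ∎
  where open ℚP.≤-Reasoning

÷ᵗ-* : ∀ c Q → 0ℚ ℚ.< Q → (c ÷ᵗ Q) ℚ.* Q ≡ c
÷ᵗ-* c (mkℚ (+ zero)   _ _) 0<Q with ℚ.positive 0<Q
... | ()
÷ᵗ-* c (mkℚ ℤ.-[1+ _ ] _ _) 0<Q with ℚ.positive 0<Q
... | ()
÷ᵗ-* c Q@(mkℚ (+ suc _) _ _) _ = begin
  c ℚ.* ℚ.1/ Q ℚ.* Q       ≡⟨ ℚP.*-assoc c (ℚ.1/ Q) Q ⟩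
  c ℚ.* (ℚ.1/ Q ℚ.* Q)     ≡⟨ cong (c ℚ.*_) (ℚP.*-inverseˡ Q) ⟩
  c ℚ.* 1ℚ                 ≡⟨ ℚP.*-identityʳ c ⟩
  c                        ∎
  where open ≡-Reasoning

near-one : ∀ r → ℚ.∣ r ℚ.- 1ℚ ∣ ℚ.< 1ℚ → r ℚ.< 1ℚ ℚ.+ 1ℚ
near-one r close with r ℚP.<? 1ℚ ℚ.+ 1ℚ
... | yes r<2 = r<2
... | no  r≮2 = ⊥-elim (ℚP.<-irrefl refl (ℚP.<-≤-trans close
                  (subst (1ℚ ℚ.≤_) (sym (ℚP.0≤p⇒∣p∣≡p (ℚP.≤-trans (ℚP.<⇒≤ (ℚP.positive⁻¹ 1ℚ)) 1≤r-1))) 1≤r-1)))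
  where
    1≤r-1 : 1ℚ ℚ.≤ r ℚ.- 1ℚ
    1≤r-1 = ℚP.+-monoˡ-≤ (ℚ.- 1ℚ) (ℚP.≮⇒≥ r≮2)

ratio-near-one : ∀ c Q → 0ℚ ℚ.< Q → ℚ.∣ (c ÷ᵗ Q) ℚ.- 1ℚ ∣ ℚ.< 1ℚ → c ℚ.< Q ℚ.+ Q
ratio-near-one c Q 0<Q close = begin-strict
  c                        ≡⟨ sym (÷ᵗ-* c Q 0<Q) ⟩
  (c ÷ᵗ Q) ℚ.* Q           <⟨ ℚP.*-monoˡ-<-pos Q {{ℚ.positive 0<Q}} (near-one (c ÷ᵗ Q) close) ⟩
  (1ℚ ℚ.+ 1ℚ) ℚ.* Q        ≡⟨ ℚP.*-distribʳ-+ Q 1ℚ 1ℚ ⟩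
  1ℚ ℚ.* Q ℚ.+ 1ℚ ℚ.* Q    ≡⟨ cong₂ ℚ._+_ (ℚP.*-identityˡ Q) (ℚP.*-identityˡ Q) ⟩
  Q ℚ.+ Q                  ∎
  where open ℚP.≤-Reasoning

archimedean : ∀ ε → 0ℚ ℚ.< ε → ∃ λ K → 1 ≤ K × invℕ K ℚ.≤ ε
archimedean (mkℚ (+ zero)   _ _) 0<ε with ℚ.positive 0<ε
... | ()
archimedean (mkℚ ℤ.-[1+ _ ] _ _) 0<ε with ℚ.positive 0<ε
... | ()
archimedean ε@(mkℚ (+ suc p) d _) _ = suc d , s≤s z≤n ,
  subst (ℚ._≤ ε) (sym (invℕ-mkℚ d)) (ℚ.*≤* (ℤP.*-monoʳ-≤-nonNeg (+ suc d) (+≤+ {1} {suc p} (s≤s z≤n))))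

ι-rescale : ∀ K a → 1 ≤ K → ι a ≡ ι (K * a) ℚ.* invℕ K
ι-rescale (suc k) a _ = begin
  ι a                                     ≡⟨ sym (ℚP.*-identityʳ (ι a)) ⟩
  ι a ℚ.* 1ℚ                              ≡⟨ cong (ι a ℚ.*_) (sym (ι*invℕ k)) ⟩
  ι a ℚ.* (ι (suc k) ℚ.* invℕ (suc k))    ≡⟨ sym (ℚP.*-assoc (ι a) (ι (suc k)) (invℕ (suc k))) ⟩
  ι a ℚ.* ι (suc k) ℚ.* invℕ (suc k)      ≡⟨ cong (ℚ._* invℕ (suc k)) (sym (trans (ι-* (suc k) a) (ℚP.*-comm (ι (suc k)) (ι a)))) ⟩
  ι (suc k * a) ℚ.* invℕ (suc k)          ∎
  where open ≡-Reasoning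

density-zero : ∀ (c : ℕ → ℕ) → (∀ K → ∃ λ N → ∀ n → N ≤ n → K * c n < n) →
               ConvergesTo (λ n → ι (c n) ÷ᵗ ι n) 0ℚ
density-zero c eventually ε 0<ε with archimedean ε 0<ε
... | K , 1≤K , 1/K≤ε with eventually K
...   | N , bound = N , close
  where
    close : ∀ n → N ≤ n → ℚ.∣ (ι (c n) ÷ᵗ ι n) ℚ.- 0ℚ ∣ ℚ.< ε
    close n N≤n = subst (ℚ._< ε) (sym ∣r-0∣≡r) r<ε
      where
        Kc<n : K * c n < n
        Kc<n = bound n N≤n
        0<n : 0ℚ ℚ.< ι n
        0<n = ι-mono-< (ℕP.≤-<-trans z≤n Kc<n)
        r : ℚ
        r = ι (c n) ÷ᵗ ι n
        r*n≡c : r ℚ.* ι n ≡ ι (c n)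
        r*n≡c = ÷ᵗ-* (ι (c n)) (ι n) 0<n
        c<εn : ι (c n) ℚ.< ε ℚ.* ι n
        c<εn = begin-strict
          ι (c n)                    ≡⟨ ι-rescale K (c n) 1≤K ⟩
          ι (K * c n) ℚ.* invℕ K     <⟨ ℚP.*-monoˡ-<-pos (invℕ K) {{ℚ.positive (invℕ-pos K 1≤K)}} (ι-mono-< Kc<n) ⟩
          ι n ℚ.* invℕ K             ≤⟨ ℚP.*-monoˡ-≤-nonNeg (ι n) {{ι-nonNeg n}} 1/K≤ε ⟩
          ι n ℚ.* ε                  ≡⟨ ℚP.*-comm (ι n) ε ⟩
          ε ℚ.* ι n                  ∎
          where open ℚP.≤-Reasoning
        r<ε : r ℚ.< ε
        r<ε = ℚP.*-cancelʳ-<-nonNeg (ι n) {{ι-nonNeg n}} (subst (ℚ._< ε ℚ.* ι n) (sym r*n≡c) c<εn)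
        0≤r : 0ℚ ℚ.≤ r
        0≤r = ℚP.*-cancelʳ-≤-pos (ι n) {{ℚ.positive 0<n}}
                (subst₂ ℚ._≤_ (sym (ℚP.*-zeroˡ (ι n))) (sym r*n≡c) (ι-mono-≤ {0} {c n} z≤n))
        ∣r-0∣≡r : ℚ.∣ r ℚ.- 0ℚ ∣ ≡ r
        ∣r-0∣≡r = trans (cong ℚ.∣_∣ (ℚP.+-identityʳ r)) (ℚP.0≤p⇒∣p∣≡p 0≤r)

scaled-comparison : ∀ M c X Q → 1 ≤ M → ι c ℚ.< Q ℚ.+ Q → ι M ℚ.* Q ℚ.≤ ι X → M * c < X + X
scaled-comparison M c X Q 1≤M c<2Q MQ≤X = ι-cancel-< (begin-strict
  ι (M * c)                    ≡⟨ ι-* M c ⟩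
  ι M ℚ.* ι c                  <⟨ ℚP.*-monoʳ-<-pos (ι M) {{ℚ.positive (ι-mono-< 1≤M)}} c<2Q ⟩
  ι M ℚ.* (Q ℚ.+ Q)            ≡⟨ ℚP.*-distribˡ-+ (ι M) Q Q ⟩
  ι M ℚ.* Q ℚ.+ ι M ℚ.* Q      ≤⟨ ℚP.+-mono-≤ MQ≤X MQ≤X ⟩
  ι X ℚ.+ ι X                  ≡⟨ sym (ι-+ X X) ⟩
  ι (X + X)                    ∎)
  where open ℚP.≤-Reasoning

zeros : ∀ j → Vec ℕ j
zeros j = tabulate (λ _ → 0)

window-zeros : ∀ G i j → (∀ u → u < j → G (i + u) ≡ 0) → window G i j ≡ zeros j
window-zeros G i j G≡0 = VecP.tabulate-cong (λ t → G≡0 (toℕ t) (toℕ<n t))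

countBlock-run : ∀ {k} (B : Vec ℕ k) G s d → 1 ≤ s → (∀ t → t ≤ d → window G (s + t) k ≡ B) →
                 suc d ≤ countBlock B G (s + d)
countBlock-run {k} B G (suc a) d _ seen = go d ℕP.≤-refl
  where
    hit : ∀ t → t ≤ d → countBlock B G (suc a + t) ≡ suc (countBlock B G (a + t))
    hit t t≤d with VecP.≡-dec _≟_ (window G (suc a + t) k) B
    ... | yes _   = refl
    ... | no  w≢B = ⊥-elim (w≢B (seen t t≤d))
    go : ∀ t → t ≤ d → suc t ≤ countBlock B G (suc a + t)
    go zero    _   = ℕP.≤-trans (s≤s z≤n) (ℕP.≤-reflexive (sym (hit 0 z≤n)))
    go (suc t) t<d = ℕP.≤-trans (s≤s (ℕP.≤-trans (go t (ℕP.<⇒≤ t<d))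
                                   (ℕP.≤-reflexive (cong (countBlock B G) (sym (ℕP.+-suc a t))))))
                       (ℕP.≤-reflexive (sym (hit (suc t) t<d)))

zero-run-blocks : ∀ F j s d → 1 ≤ s → (∀ u → u < j + d → F (s + u) ≡ 0) →
                  suc d ≤ countBlock (zeros j) F (s + d)
zero-run-blocks F j s d 1≤s zeroed = countBlock-run (zeros j) F s d 1≤s λ t t≤d →
  window-zeros F (s + t) j λ u u<j →
    subst (λ i → F i ≡ 0) (sym (ℕP.+-assoc s t u))
      (zeroed (t + u) (subst (t + u <_) (ℕP.+-comm d j) (ℕP.+-mono-≤-< t≤d u<j)))

run-slack : ∀ N j m d → j ≤ m → 4 * N + 3 * m ≤ j + d → 4 * N + 2 * j ≤ d
run-slack N j m d j≤m long = ℕP.+-cancelʳ-≤ j (4 * N + 2 * j) d (begin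
  4 * N + 2 * j + j    ≡⟨ three N j ⟩
  4 * N + 3 * j        ≤⟨ ℕP.+-monoʳ-≤ (4 * N) (ℕP.*-monoʳ-≤ 3 j≤m) ⟩
  4 * N + 3 * m        ≤⟨ long ⟩
  j + d                ≡⟨ ℕP.+-comm j d ⟩
  d + j                ∎)
  where
    open ℕP.≤-Reasoning
    three : ∀ N j → 4 * N + 2 * j + j ≡ 4 * N + 3 * j
    three = solve-∀

-- the counting inequality behind non-normality: with M = 8m and a run of length
-- j + d, d ≥ 4N + 2j, starting at m·(j + d), the d + 1 occurrences of the zero block
-- up to n = m·(j + d) + d are at least twice the bound M·N + n on M·Q_n, divided by M
long-run-arith : ∀ m N j d → 1 ≤ m → 4 * N + 2 * j ≤ d →
                 (8 * m * N + (m * (j + d) + d)) + (8 * m * N + (m * (j + d) + d)) ≤ 8 * m * suc d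
long-run-arith (suc p) N j d _ slack = subst₂ _≤_ (cong lhs d-split) (cong rhs d-split)
  (subst (lhs d′ ≤_) (sym (identity p N j e)) (ℕP.m≤m+n (lhs d′) _))
  where
    e d′ : ℕ
    e  = d ∸ (4 * N + 2 * j)
    d′ = 4 * N + 2 * j + e
    d-split : d′ ≡ d
    d-split = ℕP.m+[n∸m]≡n slack
    lhs rhs : ℕ → ℕ
    lhs d = (8 * suc p * N + (suc p * (j + d) + d)) + (8 * suc p * N + (suc p * (j + d) + d))
    rhs d = 8 * suc p * suc d
    identity : ∀ p N j e →
      8 * suc p * suc (4 * N + 2 * j + e) ≡
        ((8 * suc p * N + (suc p * (j + (4 * N + 2 * j + e)) + (4 * N + 2 * j + e))) +
         (8 * suc p * N + (suc p * (j + (4 * N + 2 * j + e)) + (4 * N + 2 * j + e)))) +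
        (8 * p * N + 10 * p * j + 6 * j + 6 * p * e + 4 * e + 8 * p + 8)
    identity = solve-∀

-- Normality of order j with ε = 1 gives N_n(0^j) < 2·Q_n^{(j)}
-- for large n.  Take the zero run m = j + N₀, of length ℓ = j + d, and n = m·ℓ + d:
-- then N_n(0^j) ≥ d + 1, while q_i ≥ 8m beyond N(8m) gives 8m·Q_n^{(j)} ≤ 8m·N(8m) + n,
-- and these contradict each other by long-run-arith.
not-normal : ∀ q → IsBasic q → (N : ℕ → ℕ) → (∀ M i → N M ≤ i → M ≤ q i) →
             ∀ F → HasLongZeroRuns (λ m → 4 * N (8 * m) + 3 * m) F → ∀ j → 1 ≤ j → ¬ QNormal q j F
not-normal q basic N large F runs j 1≤j normal
  with normal (zeros j) 1ℚ (ℚP.positive⁻¹ 1ℚ)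
... | N₀ , converges with runs (j + N₀) (ℕP.≤-trans 1≤j (ℕP.m≤m+n j N₀))
... | ℓ , long , zeroed = ℕP.<-irrefl refl (ℕP.<-≤-trans too-many (ℕP.≤-trans enough (ℕP.*-monoʳ-≤ M counted)))
  where
    m M d n : ℕ
    m = j + N₀
    M = 8 * m
    d = ℓ ∸ j
    n = m * ℓ + d
    1≤m : 1 ≤ m
    1≤m = ℕP.≤-trans 1≤j (ℕP.m≤m+n j N₀)
    j≤m : j ≤ m
    j≤m = ℕP.m≤m+n j N₀
    j≤ℓ : j ≤ ℓ
    j≤ℓ = ℕP.≤-trans (ℕP.≤-trans j≤m (ℕP.m≤n*m m 3)) (ℕP.≤-trans (ℕP.m≤n+m (3 * m) (4 * N M)) long)
    ℓ≡j+d : ℓ ≡ j + d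
    ℓ≡j+d = sym (ℕP.m+[n∸m]≡n j≤ℓ)
    m≤n : m ≤ n
    m≤n = ℕP.≤-trans (ℕP.m≤m*n m ℓ {{ℕ.>-nonZero (ℕP.≤-trans 1≤j j≤ℓ)}}) (ℕP.m≤m+n (m * ℓ) d)
    counted : suc d ≤ countBlock (zeros j) F n
    counted = zero-run-blocks F j (m * ℓ) d (ℕP.*-mono-≤ 1≤m (ℕP.≤-trans 1≤j j≤ℓ))
      (λ u u<j+d → zeroed u (subst (u <_) (sym ℓ≡j+d) u<j+d))
    too-many : M * countBlock (zeros j) F n < (M * N M + n) + (M * N M + n)
    too-many = scaled-comparison M _ (M * N M + n) (Qnk q j n) (ℕP.≤-trans 1≤m (ℕP.m≤n*m m 8))
      (ratio-near-one _ (Qnk q j n) (Qnk-pos q basic j n (ℕP.≤-trans 1≤m m≤n))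
        (converges n (ℕP.≤-trans (ℕP.m≤n+m N₀ j) m≤n)))
      (Qnk-tail q basic M (N M) (large M) j 1≤j n)
    enough : (M * N M + n) + (M * N M + n) ≤ M * suc d
    enough = subst (λ ℓ′ → (M * N M + (m * ℓ′ + d)) + (M * N M + (m * ℓ′ + d)) ≤ M * suc d) (sym ℓ≡j+d)
      (long-run-arith m (N M) j d 1≤m (run-slack (N M) j m d j≤m (subst (4 * N M + 3 * m ≤_) ℓ≡j+d long)))

mainTheorem1 : (q : ℕ → ℕ) → IsBasic q → InfiniteInLimit q →
    (k : ℕ) → 1 ≤ k → (E : ℕ → ℕ) → IsExpansion q E → QNormal q k E →
    ∃ λ (F : ℕ → ℕ) → IsExpansion q F × DiffDensityZero E F ×
      (∀ j → 1 ≤ j → ¬ QNormal q j F)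
mainTheorem1 q basic infinite _ _ E expansion _ =
  F , zeroing-expansion q E F basic expansion (zeroRuns-digit E) , density , nonNormal
  where
    N : ℕ → ℕ
    N M = proj₁ (infinite M)
    open Runs (λ m → 4 * N (8 * m) + 3 * m)
              (λ m → ℕP.≤-trans (ℕP.m≤m+n m (2 * m)) (ℕP.m≤n+m (3 * m) (4 * N (8 * m))))
    F : ℕ → ℕ
    F = zeroRuns E
    density : DiffDensityZero E F
    density = density-zero (countDiff E F) λ K →
      let (N₁ , bound) = sparse K in
      N₁ , λ n N₁≤n → ℕP.≤-<-trans (ℕP.*-monoʳ-≤ K (countDiff-≤ E F (zeroRuns-out E) n)) (bound n N₁≤n)
    nonNormal : ∀ j → 1 ≤ j → ¬ QNormal q j F
    nonNormal = not-normal q basic N (λ M → proj₂ (infinite M)) F (zeroRuns-long E)
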